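{- For every input $\boldsymbol{\sigma}$, when the min-LCR algorithm is run on $\boldsymbol{\sigma}$, $\max_{\tau}\mathsf{LCR}_{i^\star(\tau)}(\tau)\le \mathsf{r}^\star$, where $\mathsf{r}^\star=\inf_{\mathsf{ALG}}\sup_{\boldsymbol{\sigma}'} C_{\mathsf{OFF}}(\boldsymbol{\sigma}')/C_{\mathsf{ALG}}(\boldsymbol{\sigma}')$ is the optimal competitive ratio over all deterministic online algorithms.
   Context: Model: time is divided into slots $t=1,2,\dots$. An input $\boldsymbol{\sigma}$ is a finite sequence of jobs; job $J_i$ arrives at the beginning of slot $a_i$, has a value $v_i>0$ and an absolute deadline $D_i\in\{a_i,a_i+1,\dots\}\cup\{\infty\}$; it may be processed in any single slot $t$ with $a_i\le t\le D_i$ (each job takes one slot, processed at most once), otherwise dropped. In any slot, $k\ge0$ jobs can be processed at cost $g(k)$, with $g$ convex on the nonnegative integers, $g(0)=0$, $c_k=g(k)-g(k-1)>0$ for $k\ge1$. An algorithm processing job set $P_t$ in slot $t$ earns profit $C(\boldsymbol{\sigma})=\sum_t\big(\sum_{i\in P_t}v_i-g(|P_t|)\big)$. A deterministic online algorithm decides at each slot which available jobs to process, knowing only the jobs arrived so far, their values, and which are still available; deadlines are unknown to it (and may be chosen adversarially). $C_{\mathsf{OFF}}(\boldsymbol{\sigma})$ is the optimal profit of an offline algorithm knowing the whole input including deadlines. min-LCR algorithm: at slot $\tau$, let $E(\tau)$ be the set of jobs available at $\tau$ (arrived by $\tau$, not expired, not yet processed by the algorithm), sorted in non-increasing order of value;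 let $v^{(j)}$ be the $j$-th largest value and $V^{(j)}=\sum_{l\le j}v^{(l)}$. Let $m$ be the largest $j$ with $v^{(j)}-(g(j)-g(j-1))>0$. For $1\le i\le m$ define $M_{i,\tau}=V^{(i)}-i\,g(1)$, $P_{i,\tau}=V^{(i)}-g(i)$, $C_{\mathsf{Greedy}}(i,\tau)=$ the maximum over $j\ge0$ of (sum of the $j$ largest values among the jobs of $E(\tau)$ other than the top $i$) $-\,g(j)$, and $\mathsf{LCR}_i(\tau)=\dfrac{M_{i,\tau}+C_{\mathsf{Greedy}}(i,\tau)}{P_{i,\tau}}$. Let $i^\star(\tau)=\arg\min_{1\le i\le m}\mathsf{LCR}_i(\tau)$ and process the $i^\star(\tau)$ highest-valued jobs of $E(\tau)$ in slot $\tau$.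
   Formalization: The job values $v_i$ and the cost function $g$ take rational values, also for the inputs $\boldsymbol{\sigma}'$ in the definition of $\mathsf{r}^\star$. -}

module Defs where

open import Data.Bool using (Bool; true; false; _∧_; _∨_; not; if_then_else_)
open import Data.Nat as ℕ using (ℕ; zero; suc; _≤ᵇ_)
open import Data.Integer using (+_)
open import Data.Rational as ℚ using (ℚ; 0ℚ; _+_; _-_; _*_; _÷_; _⊓_; _⊔_; _≤_; _<_; ≢-nonZero)
open import Data.Rational.Properties using (_≟_)
open import Data.List using (List; []; _∷_; _++_; [_]; length; take; drop; map; zip; zipWith; replicate; concat; upTo; filterᵇ)
open import Data.List.Relation.Unary.All using (All)
open import Data.List.Relation.Unary.Unique.Propositional using (Unique)
open import Data.Maybe using (Maybe; just; nothing)
open import Data.Fin using (Fin)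
open import Data.Product using (_×_; _,_; ∃-syntax; proj₁; proj₂)
open import Data.Unit using (⊤)
open import Relation.Nullary using (yes; no)
open import Relation.Binary.PropositionalEquality using (_≡_)

ℕtoℚ : ℕ → ℚ
ℕtoℚ n = (+ n) ℚ./ 1

marginal : (ℕ → ℚ) → ℕ → ℚ
marginal g k = g k - g (k ℕ.∸ 1)

record ValidCost (g : ℕ → ℚ) : Set where
  field
    g-zero   : g 0 ≡ 0ℚ
    c-pos    : ∀ k → 0ℚ < g (suc k) - g k
    convex   : ∀ k → g (suc k) - g k ≤ g (suc (suc k)) - g (suc k)

-- Jobs and inputs.  Slots are 1,2,…; deadline nothing = ∞.

record Job : Set where
  constructor job
  field
    arrival  : ℕ
    value    : ℚ
    deadline : Maybe ℕ
open Job public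

DeadlineOK : ℕ → Maybe ℕ → Set
DeadlineOK a nothing  = ⊤
DeadlineOK a (just D) = a ℕ.≤ D

ValidJob : Job → Set
ValidJob J = (1 ℕ.≤ arrival J) × (0ℚ < value J) × DeadlineOK (arrival J) (deadline J)

Input : Set
Input = List Job

ValidInput : Input → Set
ValidInput σ = All ValidJob σ

inWindow : Job → ℕ → Bool
inWindow J t with deadline J
... | nothing = arrival J ≤ᵇ t
... | just D  = (arrival J ≤ᵇ t) ∧ (t ≤ᵇ D)

sumℚ : List ℚ → ℚ
sumℚ []       = 0ℚ
sumℚ (x ∷ xs) = x + sumℚ xs

countTrue : List Bool → ℕ
countTrue []           = 0
countTrue (true ∷ bs)  = suc (countTrue bs)
countTrue (false ∷ bs) = countTrue bs

selectedValues : Input → List Bool → List ℚ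
selectedValues []       _            = []
selectedValues (J ∷ σ) []            = []
selectedValues (J ∷ σ) (true ∷ bs)  = value J ∷ selectedValues σ bs
selectedValues (J ∷ σ) (false ∷ bs) = selectedValues σ bs

slotProfit : (ℕ → ℚ) → List ℚ → ℚ
slotProfit g vs = sumℚ vs - g (length vs)

availFlags : Input → List Bool → ℕ → List Bool
availFlags []      _        t = []
availFlags (J ∷ σ) []       t = inWindow J t ∷ availFlags σ [] t
availFlags (J ∷ σ) (p ∷ ps) t = (not p ∧ inWindow J t) ∷ availFlags σ ps t

-- At slot t the algorithm sees, for every slot 1..t, the list of
-- (arrival, value) of the jobs available in that slot (in input order);
-- it sees no deadlines and no future jobs.  It answers with one bit per
-- currently available job (positionally; missing bits = false).

View : Set
View = List (ℕ × ℚ)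

OnlineAlg : Set
OnlineAlg = List View → List Bool

viewOf : Input → List Bool → View
viewOf []       _            = []
viewOf (J ∷ σ) []            = []
viewOf (J ∷ σ) (true ∷ bs)  = (arrival J , value J) ∷ viewOf σ bs
viewOf (J ∷ σ) (false ∷ bs) = viewOf σ bs

spread : List Bool → List Bool → List Bool
spread []           bs       = []
spread (false ∷ as) bs       = false ∷ spread as bs
spread (true ∷ as)  []       = false ∷ spread as []
spread (true ∷ as)  (b ∷ bs) = b ∷ spread as bs

orFlags : List Bool → List Bool → List Bool
orFlags = zipWith _∨_

runFrom : (ℕ → ℚ) → OnlineAlg → Input → (fuel t : ℕ) → List Bool → List View → ℚ
runFrom g A σ zero       t ps hist = 0ℚ
runFrom g A σ (suc fuel) t ps hist =
  let av    = availFlags σ ps t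
      hist′ = hist ++ [ viewOf σ av ]
      sel   = spread av (A hist′)
  in slotProfit g (selectedValues σ sel)
     + runFrom g A σ fuel (suc t) (orFlags ps sel) hist′

profitALG : (ℕ → ℚ) → OnlineAlg → Input → ℕ → ℚ
profitALG g A σ T = runFrom g A σ T 1 (replicate (length σ) false) []

-- Offline schedules: the i-th list is the set of jobs processed in slot i+1.

Schedule : Input → Set
Schedule σ = List (List (Fin (length σ)))

lookupJob : (σ : Input) → Fin (length σ) → Job
lookupJob σ = Data.List.lookup σ

FeasibleFrom : (σ : Input) → ℕ → Schedule σ → Set
FeasibleFrom σ t []       = ⊤
FeasibleFrom σ t (P ∷ S)  =
  All (λ i → inWindow (lookupJob σ i) t ≡ true) P × FeasibleFrom σ (suc t) S

Feasible : (σ : Input) → Schedule σ → Set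
Feasible σ S = Unique (concat S) × FeasibleFrom σ 1 S

scheduleProfit : (ℕ → ℚ) → (σ : Input) → Schedule σ → ℚ
scheduleProfit g σ []      = 0ℚ
scheduleProfit g σ (P ∷ S) =
  slotProfit g (map (λ i → value (lookupJob σ i)) P) + scheduleProfit g σ S

-- C_OFF is the maximum of scheduleProfit over feasible schedules;
-- C_ALG is the (eventually constant) limit of profitALG over horizons.
Competitive : (ℕ → ℚ) → OnlineAlg → ℚ → Set
Competitive g A r =
  ∀ (σ′ : Input) → ValidInput σ′ → (S : Schedule σ′) → Feasible σ′ S →
  ∃[ T ] ∀ T′ → T ℕ.≤ T′ → scheduleProfit g σ′ S ≤ r * profitALG g A σ′ T′

insertDesc : ℚ → List ℚ → List ℚ
insertDesc x []       = [ x ]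
insertDesc x (y ∷ ys) with y ℚ.≤ᵇ x
... | true  = x ∷ y ∷ ys
... | false = y ∷ insertDesc x ys

sortDesc : List ℚ → List ℚ
sortDesc []       = []
sortDesc (x ∷ xs) = insertDesc x (sortDesc xs)

topSum : List ℚ → ℕ → ℚ
topSum ds j = sumℚ (take j ds)

-- j-th largest value (1-based); 0 if out of range
nth : List ℚ → ℕ → ℚ
nth []       _             = 0ℚ
nth (x ∷ xs) zero          = 0ℚ
nth (x ∷ xs) (suc zero)    = x
nth (x ∷ xs) (suc (suc j)) = nth xs (suc j)

mIndex : (ℕ → ℚ) → List ℚ → ℕ
mIndex g ds = go (length ds)
  where
  go : ℕ → ℕ
  go zero    = 0
  go (suc j) with 0ℚ ℚ.<? (nth ds (suc j) - marginal g (suc j))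
  ... | yes _ = suc j
  ... | no  _ = go j

maxℚ : List ℚ → ℚ → ℚ
maxℚ []       d = d
maxℚ (x ∷ xs) d = x ⊔ maxℚ xs d

greedy : (ℕ → ℚ) → List ℚ → ℚ
greedy g ds = maxℚ (map (λ j → topSum ds j - g j) (upTo (suc (length ds)))) 0ℚ

M : (ℕ → ℚ) → List ℚ → ℕ → ℚ
M g ds i = topSum ds i - ℕtoℚ i * g 1

P : (ℕ → ℚ) → List ℚ → ℕ → ℚ
P g ds i = topSum ds i - g i

CGreedy : (ℕ → ℚ) → List ℚ → ℕ → ℚ
CGreedy g ds i = greedy g (drop i ds)

-- division totalised by 0 when the denominator is 0 (never used: P > 0 for 1 ≤ i ≤ m)
_/′_ : ℚ → ℚ → ℚ
p /′ q with q ≟ 0ℚ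
... | yes _  = 0ℚ
... | no q≢0 = _÷_ p q {{≢-nonZero q≢0}}

LCR : (ℕ → ℚ) → List ℚ → ℕ → ℚ
LCR g ds i = (M g ds i + CGreedy g ds i) /′ P g ds i

minLCR : (ℕ → ℚ) → List ℚ → ℚ
minLCR g ds = go (mIndex g ds)
  where
  go : ℕ → ℚ
  go zero          = 0ℚ
  go (suc zero)    = LCR g ds 1
  go (suc (suc k)) = go (suc k) ⊓ LCR g ds (suc (suc k))

-- Runs of min-LCR (any tie-breaking).  S t = flags (over σ) of the jobs
-- processed in slot t.

processedBefore : Input → (ℕ → List Bool) → ℕ → List Bool
processedBefore σ S zero          = replicate (length σ) false
processedBefore σ S (suc zero)    = replicate (length σ) false
processedBefore σ S (suc (suc t)) = orFlags (processedBefore σ S (suc t)) (S (suc t))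

Eflags : Input → (ℕ → List Bool) → ℕ → List Bool
Eflags σ S τ = availFlags σ (processedBefore σ S τ) τ

Evalues : Input → (ℕ → List Bool) → ℕ → List ℚ
Evalues σ S τ = sortDesc (selectedValues σ (Eflags σ S τ))

Implies : Bool → Bool → Set
Implies true  b = b ≡ true
Implies false b = ⊤

SubsetFlags : List Bool → List Bool → Set
SubsetFlags sel E = All (λ p → Implies (proj₁ p) (proj₂ p)) (zip sel E)

TopValued : Input → List Bool → List Bool → Set
TopValued σ sel E =
  All (λ x → All (λ y → value (proj₁ y) ≤ value x)
                 (filterᵇ (λ y → not (proj₁ (proj₂ y)) ∧ proj₂ (proj₂ y)) (zip σ (zip sel E))))
      (map proj₁ (filterᵇ (λ x → proj₁ (proj₂ x)) (zip σ (zip sel E))))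

record MinLCRRun (g : ℕ → ℚ) (σ : Input) (S : ℕ → List Bool) : Set where
  field
    len      : ∀ τ → length (S τ) ≡ length σ
    subset   : ∀ τ → 1 ℕ.≤ τ → SubsetFlags (S τ) (Eflags σ S τ)
    top      : ∀ τ → 1 ℕ.≤ τ → TopValued σ (S τ) (Eflags σ S τ)
    idle     : ∀ τ → 1 ℕ.≤ τ → mIndex g (Evalues σ S τ) ≡ 0 → countTrue (S τ) ≡ 0
    count-ok : ∀ τ → 1 ℕ.≤ τ → 1 ℕ.≤ mIndex g (Evalues σ S τ) →
               (1 ℕ.≤ countTrue (S τ)) × (countTrue (S τ) ℕ.≤ mIndex g (Evalues σ S τ))
    argmin   : ∀ τ → 1 ℕ.≤ τ → 1 ℕ.≤ mIndex g (Evalues σ S τ) →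
               LCR g (Evalues σ S τ) (countTrue (S τ)) ≡ minLCR g (Evalues σ S τ)

{-# OPTIONS --safe #-}
-- Fix a slot whose available values, sorted, are ds, with m = mIndex ≥ 1, and
-- an r-competitive algorithm A.  Show A jobs of values ds, all arriving in slot
-- 1, and let exactly the jobs A processes in slot 1 live forever; A then earns
-- ALG = Σ X − g |X| for the set X it picks.  A single job of value d > g 1
-- forces r ≥ 1 and ALG > 0, and cutting X down to its i = min(|X|, m) largest
-- members does not lower ALG, because the values beyond position m lie below
-- the marginal costs.  Offline one may run any j of the unpicked jobs together
-- in slot 1 and the i kept jobs alone afterwards; with r ≥ 1 this gives
-- V_j(drop i ds) − g j + M_i ≤ r P_i for every j, i.e. LCR_i ≤ r, and the
-- min-LCR choice has LCR at most LCR_i.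
module Submission where

open import Defs
open import Data.Nat using (ℕ; _≤_)
open import Data.Rational using (ℚ)
open import Data.Rational as Q using ()
open import Data.List using (List)
open import Data.Bool using (Bool)

open import Data.Bool using (true; false; T; if_then_else_)
open import Data.Bool.Properties using (∨-identityʳ)
open import Data.Empty using (⊥; ⊥-elim)
open import Data.Fin as Fin using (Fin; zero; suc)
import Data.Fin.Properties as FinP
import Data.Integer as ℤ
open import Data.List using ([]; _∷_; [_]; _++_; length; take; drop; map; replicate; lookup)
import Data.List.Properties as ListP
open import Data.List.Membership.Propositional using (_∈_; _∉_)
open import Data.List.Membership.Propositional.Properties using (∈-map⁻)
open import Data.List.Relation.Binary.Disjoint.Propositional using (Disjoint)
import Data.List.Relation.Binary.Pointwise.Properties as PointwiseP
open import Data.List.Relation.Binary.Prefix.Heterogeneous using (Prefix; []; _∷_)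
import Data.List.Relation.Binary.Prefix.Heterogeneous.Properties as PrefixP
open import Data.List.Relation.Unary.All as All using (All; []; _∷_)
import Data.List.Relation.Unary.All.Properties as AllP
open import Data.List.Relation.Unary.AllPairs as AllPairs using (AllPairs; []; _∷_)
open import Data.List.Relation.Unary.Any using (here; there)
open import Data.List.Relation.Unary.Unique.Propositional using (Unique)
import Data.List.Relation.Unary.Unique.Propositional.Properties as UniqueP
open import Data.Maybe using (nothing; just)
open import Data.Nat as ℕ using (zero; suc; _<_; _⊓_; z≤n; s≤s)
import Data.Nat.Coprimality as Coprimality
import Data.Nat.Properties as ℕP
open import Data.Product using (_×_; _,_; proj₁; proj₂; ∃-syntax)
open import Data.Rational
  using (0ℚ; 1ℚ; _+_; _-_; _*_; -_; mkℚ)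
  renaming (_≤_ to _≤ℚ_; _<_ to _<ℚ_; _≥_ to _≥ℚ_; _⊓_ to _⊓ℚ_)
import Data.Rational.Properties as QP
open import Data.Rational.Solver using (module +-*-Solver)
open import Data.Sum using (_⊎_; inj₁; inj₂)
open import Data.Unit using (⊤; tt)
open import Function using (_∘_; Injective)
open import Relation.Nullary using (¬_; yes; no)
open import Relation.Binary.PropositionalEquality
  using (_≡_; refl; sym; trans; cong; cong₂; subst; subst₂)

open QP.≤-Reasoning
open +-*-Solver using (solve; con; _:+_; _:-_; _:*_; _:=_)

private
  variable
    X : Set

0≤q-p : ∀ {p q} → p ≤ℚ q → 0ℚ ≤ℚ q - p
0≤q-p {p} {q} p≤q = subst (_≤ℚ q - p) (QP.+-inverseʳ p) (QP.+-monoˡ-≤ (- p) p≤q)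

p-q≤0⇒p≤q : ∀ {p q} → p - q ≤ℚ 0ℚ → p ≤ℚ q
p-q≤0⇒p≤q {p} {q} p-q≤0 = begin
  p             ≡⟨ solve 2 (λ p q → p := (p :- q) :+ q) refl p q ⟩
  (p - q) + q   ≤⟨ QP.+-monoˡ-≤ q p-q≤0 ⟩
  0ℚ + q        ≡⟨ QP.+-identityˡ q ⟩
  q             ∎

p+q≤s⇒p≤s-q : ∀ {p q s} → p + q ≤ℚ s → p ≤ℚ s - q
p+q≤s⇒p≤s-q {p} {q} {s} p+q≤s = begin
  p             ≡⟨ solve 2 (λ p q → p := (p :+ q) :- q) refl p q ⟩
  (p + q) - q   ≤⟨ QP.+-monoˡ-≤ (- q) p+q≤s ⟩
  s - q         ∎

p≤r*p : ∀ {p r} → 1ℚ ≤ℚ r → 0ℚ ≤ℚ p → p ≤ℚ r * p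
p≤r*p {p} {r} 1≤r 0≤p =
  subst (_≤ℚ r * p) (QP.*-identityˡ p) (QP.*-monoʳ-≤-nonNeg p {{Q.nonNegative 0≤p}} 1≤r)

-- With r ≥ 1, raising y to t gains at least as much on the right as on the left.
ratio-bound-mono : ∀ {a y t c h r} → 1ℚ ≤ℚ r → y ≤ℚ t →
                   a + (y - c) ≤ℚ r * (y - h) → a ≤ℚ r * (t - h) - (t - c)
ratio-bound-mono {a} {y} {t} {c} {h} {r} 1≤r y≤t bound = p+q≤s⇒p≤s-q (begin
  a + (t - c)                ≡⟨ solve 4 (λ a y t c → a :+ (t :- c) := (a :+ (y :- c)) :+ (t :- y)) refl a y t c ⟩
  (a + (y - c)) + (t - y)    ≤⟨ QP.+-mono-≤ bound (p≤r*p 1≤r (0≤q-p y≤t)) ⟩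
  r * (y - h) + r * (t - y)  ≡⟨ solve 4 (λ y t h r → r :* (y :- h) :+ r :* (t :- y) := r :* (t :- h)) refl y t h r ⟩
  r * (t - h)                ∎)

/′-≤ : ∀ {p q r} → 0ℚ <ℚ q → p ≤ℚ r * q → p /′ q ≤ℚ r
/′-≤ {p} {q} {r} 0<q p≤rq with q QP.≟ 0ℚ
... | yes q≡0 = ⊥-elim (QP.<-irrefl (sym q≡0) 0<q)
... | no q≢0 = QP.*-cancelʳ-≤-pos q {{Q.positive 0<q}} (begin
  (p Q.÷ q) * q      ≡⟨ QP.*-assoc p (Q.1/ q) q ⟩
  p * (Q.1/ q * q)   ≡⟨ cong (p *_) (QP.*-inverseˡ q) ⟩
  p * 1ℚ             ≡⟨ QP.*-identityʳ p ⟩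
  p                  ≤⟨ p≤rq ⟩
  r * q              ∎)
  where
  instance
    q-nonZero : Q.NonZero q
    q-nonZero = Q.≢-nonZero q≢0

maxℚ-lub : ∀ {b} xs d → All (_≤ℚ b) xs → d ≤ℚ b → maxℚ xs d ≤ℚ b
maxℚ-lub []       d []         d≤b = d≤b
maxℚ-lub (x ∷ xs) d (x≤b ∷ xs≤b) d≤b = QP.⊔-lub x≤b (maxℚ-lub xs d xs≤b d≤b)

sumℚ-++ : ∀ xs ys → sumℚ (xs ++ ys) ≡ sumℚ xs + sumℚ ys
sumℚ-++ []       ys = sym (QP.+-identityˡ (sumℚ ys))
sumℚ-++ (x ∷ xs) ys = trans (cong (x +_) (sumℚ-++ xs ys)) (sym (QP.+-assoc x (sumℚ xs) (sumℚ ys)))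

sumℚ-nonNeg : ∀ {xs} → All (0ℚ ≤ℚ_) xs → 0ℚ ≤ℚ sumℚ xs
sumℚ-nonNeg []           = QP.≤-refl
sumℚ-nonNeg (0≤x ∷ 0≤xs) = QP.+-mono-≤ 0≤x (sumℚ-nonNeg 0≤xs)

ℕtoℚ-suc : ∀ n → ℕtoℚ (suc n) ≡ 1ℚ + ℕtoℚ n
ℕtoℚ-suc zero    = refl
ℕtoℚ-suc (suc n) = sym (trans
  (cong (1ℚ +_) (QP.↥p/↧p≡p (mkℚ (ℤ.+ suc n) 0 (Coprimality.sym (Coprimality.1-coprimeTo (suc n))))))
  (cong (λ k → ℤ.+ suc k Q./ 1) (ℕP.*-identityʳ (suc n))))

-- Descending lists and domination

Descending : List ℚ → Set
Descending = AllPairs _≥ℚ_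

insertDesc-All : ∀ {P : ℚ → Set} {x} ys → P x → All P ys → All P (insertDesc x ys)
insertDesc-All []       px []         = px ∷ []
insertDesc-All {x = x} (y ∷ ys) px (py ∷ pys) with y Q.≤ᵇ x
... | true  = px ∷ py ∷ pys
... | false = py ∷ insertDesc-All ys px pys

insertDesc-descending : ∀ x {ys} → Descending ys → Descending (insertDesc x ys)
insertDesc-descending x {[]}     []                 = [] ∷ []
insertDesc-descending x {y ∷ ys} (y≥ys ∷ ys-desc) with y Q.≤ᵇ x in y≤ᵇx
... | true  = (y≤x ∷ All.map (λ z≤y → QP.≤-trans z≤y y≤x) y≥ys) ∷ y≥ys ∷ ys-desc
  where
  y≤x : y ≤ℚ x
  y≤x = QP.≤ᵇ⇒≤ (subst T (sym y≤ᵇx) tt)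
... | false = insertDesc-All ys x≤y y≥ys ∷ insertDesc-descending x ys-desc
  where
  x≤y : x ≤ℚ y
  x≤y = QP.<⇒≤ (QP.≰⇒> (λ y≤x → subst T y≤ᵇx (QP.≤⇒≤ᵇ y≤x)))

sortDesc-All : ∀ {P : ℚ → Set} {xs} → All P xs → All P (sortDesc xs)
sortDesc-All []         = []
sortDesc-All (px ∷ pxs) = insertDesc-All _ px (sortDesc-All pxs)

sortDesc-descending : ∀ xs → Descending (sortDesc xs)
sortDesc-descending []       = []
sortDesc-descending (x ∷ xs) = insertDesc-descending x (sortDesc-descending xs)

infix 4 _≼_

_≼_ : List ℚ → List ℚ → Set
_≼_ = Prefix _≤ℚ_

≼-refl : ∀ {xs} → xs ≼ xs
≼-refl = PrefixP.fromPointwise (PointwiseP.refl QP.≤-refl)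

≼-trans : ∀ {xs ys zs} → xs ≼ ys → ys ≼ zs → xs ≼ zs
≼-trans = PrefixP.trans QP.≤-trans

sumℚ-≼ : ∀ {xs ys} → xs ≼ ys → All (0ℚ ≤ℚ_) ys → sumℚ xs ≤ℚ sumℚ ys
sumℚ-≼ []           0≤ys         = sumℚ-nonNeg 0≤ys
sumℚ-≼ (x≤y ∷ xs≼ys) (_ ∷ 0≤ys) = QP.+-mono-≤ x≤y (sumℚ-≼ xs≼ys 0≤ys)

tail-≼ : ∀ {x xs} → Descending (x ∷ xs) → xs ≼ x ∷ xs
tail-≼ {xs = []}     _                  = []
tail-≼ {xs = y ∷ ys} ((y≤x ∷ _) ∷ desc) = y≤x ∷ tail-≼ desc

drop-∷-≼ : ∀ {x xs ys} → Descending (x ∷ xs) → ∀ c → drop c xs ≼ ys → drop c (x ∷ xs) ≼ x ∷ ys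
drop-∷-≼               _                  zero          xs≼ys = QP.≤-refl ∷ xs≼ys
drop-∷-≼ {xs = []}     _                  (suc zero)    _     = []
drop-∷-≼ {xs = []}     _                  (suc (suc c)) _     = []
drop-∷-≼ {xs = y ∷ ys} ((y≤x ∷ _) ∷ desc) (suc c)       xs≼ys =
  ≼-trans (drop-∷-≼ desc c xs≼ys) (y≤x ∷ ≼-refl)

nth-≤ : ∀ {d} xs → All (_≤ℚ d) xs → 0ℚ ≤ℚ d → ∀ j → nth xs j ≤ℚ d
nth-≤ []       _              0≤d _             = 0≤d
nth-≤ (x ∷ xs) _              0≤d zero          = 0≤d
nth-≤ (x ∷ xs) (x≤d ∷ _)      0≤d (suc zero)    = x≤d
nth-≤ (x ∷ xs) (_ ∷ xs≤d)     0≤d (suc (suc j)) = nth-≤ xs xs≤d 0≤d (suc j)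

nth-drop : ∀ m xs j → nth (drop m xs) (suc j) ≡ nth xs (m ℕ.+ suc j)
nth-drop zero    xs       j = refl
nth-drop (suc m) []       j = refl
nth-drop (suc m) (x ∷ xs) j rewrite ℕP.+-suc m j = trans (nth-drop m xs j) (cong (nth xs) (ℕP.+-suc m j))

-- Bits missing at the end of a mask count as false, as in `spread`.
selected : List X → List Bool → List X
selected _        []           = []
selected []       (_ ∷ _)      = []
selected (x ∷ xs) (true ∷ bs)  = x ∷ selected xs bs
selected (x ∷ xs) (false ∷ bs) = selected xs bs

unselected : List X → List Bool → List X
unselected xs       []           = xs
unselected []       (_ ∷ _)      = []
unselected (x ∷ xs) (true ∷ bs)  = unselected xs bs
unselected (x ∷ xs) (false ∷ bs) = x ∷ unselected xs bs

Submask : List Bool → List Bool → Set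
Submask []          _           = ⊤
Submask (false ∷ y) []          = Submask y []
Submask (true ∷ y)  []          = ⊥
Submask (false ∷ y) (_ ∷ b)     = Submask y b
Submask (true ∷ y)  (true ∷ b)  = Submask y b
Submask (true ∷ y)  (false ∷ b) = ⊥

DisjointMasks : List Bool → List Bool → Set
DisjointMasks []          _           = ⊤
DisjointMasks (_ ∷ _)     []          = ⊤
DisjointMasks (true ∷ z)  (true ∷ y)  = ⊥
DisjointMasks (true ∷ z)  (false ∷ y) = DisjointMasks z y
DisjointMasks (false ∷ z) (_ ∷ y)     = DisjointMasks z y

firstTrues : ℕ → List Bool → List Bool
firstTrues zero    _           = []
firstTrues (suc i) []          = []
firstTrues (suc i) (true ∷ b)  = true ∷ firstTrues i b
firstTrues (suc i) (false ∷ b) = false ∷ firstTrues (suc i) b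

firstFalses : ℕ → List Bool → List Bool
firstFalses zero    _           = []
firstFalses (suc j) []          = replicate (suc j) true
firstFalses (suc j) (true ∷ y)  = false ∷ firstFalses (suc j) y
firstFalses (suc j) (false ∷ y) = true ∷ firstFalses j y

selected-singleton : ∀ (x : X) b → selected [ x ] b ≡ [ x ] ⊎ selected [ x ] b ≡ []
selected-singleton x []              = inj₂ refl
selected-singleton x (true ∷ [])     = inj₁ refl
selected-singleton x (true ∷ _ ∷ _)  = inj₁ refl
selected-singleton x (false ∷ [])    = inj₂ refl
selected-singleton x (false ∷ _ ∷ _) = inj₂ refl

All-selected : ∀ {P : X → Set} {xs} b → All P xs → All P (selected xs b)
All-selected []          _          = []
All-selected (_ ∷ _)     []         = []
All-selected (true ∷ b)  (px ∷ pxs) = px ∷ All-selected b pxs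
All-selected (false ∷ b) (px ∷ pxs) = All-selected b pxs

All-unselected : ∀ {P : X → Set} {xs} b → All P xs → All P (unselected xs b)
All-unselected []          pxs        = pxs
All-unselected (_ ∷ _)     []         = []
All-unselected (true ∷ b)  (px ∷ pxs) = All-unselected b pxs
All-unselected (false ∷ b) (px ∷ pxs) = px ∷ All-unselected b pxs

map-selected : ∀ {B : Set} (f : X → B) xs b → map f (selected xs b) ≡ selected (map f xs) b
map-selected f xs       []          = refl
map-selected f []       (_ ∷ _)     = refl
map-selected f (x ∷ xs) (true ∷ b)  = cong (f x ∷_) (map-selected f xs b)
map-selected f (x ∷ xs) (false ∷ b) = map-selected f xs b

selected-replicate-true : ∀ (xs : List X) n → selected xs (replicate n true) ≡ take n xs
selected-replicate-true xs       zero    = refl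
selected-replicate-true []       (suc n) = refl
selected-replicate-true (x ∷ xs) (suc n) = cong (x ∷_) (selected-replicate-true xs n)

selected-firstTrues : ∀ (xs : List X) i b → selected xs (firstTrues i b) ≡ take i (selected xs b)
selected-firstTrues xs       zero    b           = refl
selected-firstTrues xs       (suc i) []          = refl
selected-firstTrues []       (suc i) (true ∷ b)  = refl
selected-firstTrues []       (suc i) (false ∷ b) = refl
selected-firstTrues (x ∷ xs) (suc i) (true ∷ b)  = cong (x ∷_) (selected-firstTrues xs i b)
selected-firstTrues (x ∷ xs) (suc i) (false ∷ b) = selected-firstTrues xs (suc i) b

firstTrues-submask : ∀ i b → Submask (firstTrues i b) b
firstTrues-submask zero    b           = tt
firstTrues-submask (suc i) []          = tt
firstTrues-submask (suc i) (true ∷ b)  = firstTrues-submask i b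
firstTrues-submask (suc i) (false ∷ b) = firstTrues-submask (suc i) b

selected-firstFalses : ∀ (xs : List X) j y → selected xs (firstFalses j y) ≡ take j (unselected xs y)
selected-firstFalses xs       zero    y           = refl
selected-firstFalses xs       (suc j) []          = selected-replicate-true xs (suc j)
selected-firstFalses []       (suc j) (true ∷ y)  = refl
selected-firstFalses []       (suc j) (false ∷ y) = refl
selected-firstFalses (x ∷ xs) (suc j) (true ∷ y)  = selected-firstFalses xs (suc j) y
selected-firstFalses (x ∷ xs) (suc j) (false ∷ y) = cong (x ∷_) (selected-firstFalses xs j y)

firstFalses-disjoint : ∀ j y → DisjointMasks (firstFalses j y) y
firstFalses-disjoint zero    y           = tt
firstFalses-disjoint (suc j) []          = tt
firstFalses-disjoint (suc j) (true ∷ y)  = firstFalses-disjoint (suc j) y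
firstFalses-disjoint (suc j) (false ∷ y) = firstFalses-disjoint j y

selected-≼ : ∀ {xs} → Descending xs → ∀ b → selected xs b ≼ xs
selected-≼ {xs}     _                []          = []
selected-≼ {[]}     _                (_ ∷ _)     = []
selected-≼ {x ∷ xs} (_ ∷ desc)       (true ∷ b)  = QP.≤-refl ∷ selected-≼ desc b
selected-≼ {x ∷ xs} (x≥xs ∷ desc)    (false ∷ b) = ≼-trans (selected-≼ desc b) (tail-≼ (x≥xs ∷ desc))

drop-selected-≼-unselected : ∀ {xs} → Descending xs → ∀ b →
                             drop (length (selected xs b)) xs ≼ unselected xs b
drop-selected-≼-unselected {xs}     _             []          = ≼-refl
drop-selected-≼-unselected {[]}     _             (_ ∷ _)     = []
drop-selected-≼-unselected {x ∷ xs} (_ ∷ desc)    (true ∷ b)  = drop-selected-≼-unselected desc b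
drop-selected-≼-unselected {x ∷ xs} (x≥xs ∷ desc) (false ∷ b) =
  drop-∷-≼ (x≥xs ∷ desc) (length (selected xs b)) (drop-selected-≼-unselected desc b)

positions : (xs : List X) → List Bool → List (Fin (length xs))
positions _        []          = []
positions []       (_ ∷ _)     = []
positions (x ∷ xs) (true ∷ b)  = zero ∷ map suc (positions xs b)
positions (x ∷ xs) (false ∷ b) = map suc (positions xs b)

map-lookup-positions : ∀ (xs : List X) b → map (lookup xs) (positions xs b) ≡ selected xs b
map-lookup-positions xs       []          = refl
map-lookup-positions []       (_ ∷ _)     = refl
map-lookup-positions (x ∷ xs) (true ∷ b)  =
  cong (x ∷_) (trans (sym (ListP.map-∘ (positions xs b))) (map-lookup-positions xs b))
map-lookup-positions (x ∷ xs) (false ∷ b) =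
  trans (sym (ListP.map-∘ (positions xs b))) (map-lookup-positions xs b)

All-positions : ∀ {P : X → Set} xs b → All P (selected xs b) → All (P ∘ lookup xs) (positions xs b)
All-positions {P = P} xs b p = AllP.map⁻ (subst (All P) (sym (map-lookup-positions xs b)) p)

zero∉map-suc : ∀ {n} (is : List (Fin n)) → Fin.zero ∉ map Fin.suc is
zero∉map-suc is 0∈ with ∈-map⁻ Fin.suc 0∈
... | _ , _ , ()

Disjoint-map : ∀ {B : Set} {f : X → B} → Injective _≡_ _≡_ f →
               ∀ {xs ys} → Disjoint xs ys → Disjoint (map f xs) (map f ys)
Disjoint-map {f = f} f-inj {ys = ys} xs#ys (u∈ , v∈) with ∈-map⁻ f u∈ | ∈-map⁻ f v∈
... | a , a∈ , refl | b , b∈ , fa≡fb = xs#ys (a∈ , subst (_∈ ys) (sym (f-inj fa≡fb)) b∈)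

positions-unique : ∀ (xs : List X) b → Unique (positions xs b)
positions-unique xs       []          = []
positions-unique []       (_ ∷ _)     = []
positions-unique (x ∷ xs) (true ∷ b)  =
  AllP.map⁺ (All.universal (λ _ ()) (positions xs b)) ∷ UniqueP.map⁺ FinP.suc-injective (positions-unique xs b)
positions-unique (x ∷ xs) (false ∷ b) = UniqueP.map⁺ FinP.suc-injective (positions-unique xs b)

positions-disjoint : ∀ (xs : List X) z y → DisjointMasks z y → Disjoint (positions xs z) (positions xs y)
positions-disjoint xs       []          y           _    (() , _)
positions-disjoint xs       (_ ∷ _)     []          _    (_ , ())
positions-disjoint []       (_ ∷ _)     (_ ∷ _)     _    (() , _)
positions-disjoint (x ∷ xs) (true ∷ z)  (true ∷ y)  ()
positions-disjoint (x ∷ xs) (true ∷ z)  (false ∷ y) _    (here refl , v∈) = zero∉map-suc _ v∈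
positions-disjoint (x ∷ xs) (true ∷ z)  (false ∷ y) z#y  (there u∈ , v∈) =
  Disjoint-map FinP.suc-injective (positions-disjoint xs z y z#y) (u∈ , v∈)
positions-disjoint (x ∷ xs) (false ∷ z) (true ∷ y)  _    (u∈ , here refl) = zero∉map-suc _ u∈
positions-disjoint (x ∷ xs) (false ∷ z) (true ∷ y)  z#y  (u∈ , there v∈) =
  Disjoint-map FinP.suc-injective (positions-disjoint xs z y z#y) (u∈ , v∈)
positions-disjoint (x ∷ xs) (false ∷ z) (false ∷ y) z#y  =
  Disjoint-map FinP.suc-injective (positions-disjoint xs z y z#y)

-- Profits of slots and schedules

soloProfit : (ℕ → ℚ) → List ℚ → ℚ
soloProfit g vs = sumℚ vs - ℕtoℚ (length vs) * g 1

soloProfit-[] : ∀ g → soloProfit g [] ≡ 0ℚ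
soloProfit-[] g = cong (λ x → 0ℚ - x) (QP.*-zeroˡ (g 1))

soloProfit-∷ : ∀ g v vs → soloProfit g (v ∷ vs) ≡ slotProfit g [ v ] + soloProfit g vs
soloProfit-∷ g v vs rewrite ℕtoℚ-suc (length vs) =
  solve 4 (λ v s n c → (v :+ s) :- (con 1ℚ :+ n) :* c := ((v :+ con 0ℚ) :- c) :+ (s :- n :* c)) refl v (sumℚ vs) (ℕtoℚ (length vs)) (g 1)

slotProfit-[] : ∀ g → g 0 ≡ 0ℚ → slotProfit g [] ≡ 0ℚ
slotProfit-[] g g0 = cong (λ x → 0ℚ - x) g0

slotProfit-nonempty : ∀ g → g 0 ≡ 0ℚ → ∀ xs → 0ℚ <ℚ slotProfit g xs → 1 ≤ length xs
slotProfit-nonempty g g0 []      0<profit = ⊥-elim (QP.<-irrefl (sym (slotProfit-[] g g0)) 0<profit)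
slotProfit-nonempty g g0 (_ ∷ _) _        = s≤s z≤n

BelowMarginals : (ℕ → ℚ) → ℕ → List ℚ → Set
BelowMarginals g s []       = ⊤
BelowMarginals g s (x ∷ xs) = x ≤ℚ marginal g (suc s) × BelowMarginals g (suc s) xs

BelowMarginals-≼ : ∀ {g s xs ys} → ys ≼ xs → BelowMarginals g s xs → BelowMarginals g s ys
BelowMarginals-≼ []            _              = tt
BelowMarginals-≼ (y≤x ∷ ys≼xs) (x≤c , xs≤cs) = QP.≤-trans y≤x x≤c , BelowMarginals-≼ ys≼xs xs≤cs

BelowMarginals-nth : ∀ {g} s xs → (∀ j → 1 ≤ j → j ≤ length xs → nth xs j ≤ℚ marginal g (s ℕ.+ j)) →
                     BelowMarginals g s xs
BelowMarginals-nth         s []       _      = tt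
BelowMarginals-nth {g = g} s (x ∷ xs) bounds =
  subst (λ k → x ≤ℚ marginal g k) (ℕP.+-comm s 1) (bounds 1 (s≤s z≤n) (s≤s z≤n)) ,
  BelowMarginals-nth (suc s) xs tail-bounds
  where
  tail-bounds : ∀ j → 1 ≤ j → j ≤ length xs → nth xs j ≤ℚ marginal g (suc s ℕ.+ j)
  tail-bounds (suc j) _ j≤n =
    subst (λ k → nth xs (suc j) ≤ℚ marginal g k) (ℕP.+-suc s (suc j)) (bounds (suc (suc j)) (s≤s z≤n) (s≤s j≤n))

sumℚ-≤-cost-increase : ∀ {g} s xs → BelowMarginals g s xs → sumℚ xs ≤ℚ g (s ℕ.+ length xs) - g s
sumℚ-≤-cost-increase {g} s [] _ rewrite ℕP.+-identityʳ s = QP.≤-reflexive (sym (QP.+-inverseʳ (g s)))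
sumℚ-≤-cost-increase {g} s (x ∷ xs) (x≤c , xs≤cs) rewrite ℕP.+-suc s (length xs) = begin
  x + sumℚ xs
    ≤⟨ QP.+-mono-≤ x≤c (sumℚ-≤-cost-increase (suc s) xs xs≤cs) ⟩
  (g (suc s) - g s) + (g (suc s ℕ.+ length xs) - g (suc s))
    ≡⟨ solve 3 (λ a b c → (a :- b) :+ (c :- a) := c :- b) refl (g (suc s)) (g s) (g (suc s ℕ.+ length xs)) ⟩
  g (suc s ℕ.+ length xs) - g s
    ∎

slotProfit-++-≤ : ∀ {g} xs ys → BelowMarginals g (length xs) ys → slotProfit g (xs ++ ys) ≤ℚ slotProfit g xs
slotProfit-++-≤ {g} xs ys ys≤cs = begin
  sumℚ (xs ++ ys) - g (length (xs ++ ys))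
    ≡⟨ cong₂ (λ s n → s - g n) (sumℚ-++ xs ys) (ListP.length-++ xs) ⟩
  (sumℚ xs + sumℚ ys) - g (length xs ℕ.+ length ys)
    ≤⟨ QP.+-monoˡ-≤ (- g (length xs ℕ.+ length ys)) (QP.+-monoʳ-≤ (sumℚ xs) (sumℚ-≤-cost-increase (length xs) ys ys≤cs)) ⟩
  (sumℚ xs + (g (length xs ℕ.+ length ys) - g (length xs))) - g (length xs ℕ.+ length ys)
    ≡⟨ solve 3 (λ s a b → (s :+ (a :- b)) :- a := s :- b) refl (sumℚ xs) (g (length xs ℕ.+ length ys)) (g (length xs)) ⟩
  sumℚ xs - g (length xs)
    ∎

marginal-mono : ∀ {g} → ValidCost g → ∀ {a b} → a ≤ b → marginal g (suc a) ≤ℚ marginal g (suc b)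
marginal-mono vc {b = zero}  z≤n = QP.≤-refl
marginal-mono vc {b = suc b} a≤b with ℕP.m≤n⇒m<n∨m≡n a≤b
... | inj₁ (s≤s a≤b′) = QP.≤-trans (marginal-mono vc a≤b′) (ValidCost.convex vc b)
... | inj₂ refl       = QP.≤-refl

g₁≤marginal : ∀ {g} → ValidCost g → ∀ {m} → 1 ≤ m → g 1 ≤ℚ marginal g m
g₁≤marginal {g} vc {suc m} _ = subst (_≤ℚ marginal g (suc m)) marginal₁ (marginal-mono vc z≤n)
  where
  marginal₁ : marginal g 1 ≡ g 1
  marginal₁ = trans (cong (λ x → g 1 - x) (ValidCost.g-zero vc)) (QP.+-identityʳ (g 1))

NeverExpires : Job → Set
NeverExpires J = ∀ t → 1 ≤ t → inWindow J t ≡ true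

postponedSchedule : (σ : Input) → List Bool → List Bool → Schedule σ
postponedSchedule σ z y = positions σ z ∷ map [_] (positions σ y)

FeasibleFrom-singletons : ∀ σ {t} (is : List (Fin (length σ))) → 1 ≤ t →
                          All (NeverExpires ∘ lookupJob σ) is → FeasibleFrom σ t (map [_] is)
FeasibleFrom-singletons σ     []       _   _                  = tt
FeasibleFrom-singletons σ {t} (i ∷ is) 1≤t (i-open ∷ is-open) =
  (i-open t 1≤t ∷ []) , FeasibleFrom-singletons σ is (s≤s z≤n) is-open

postponedSchedule-feasible : ∀ σ z y → DisjointMasks z y →
                             All (λ J → inWindow J 1 ≡ true) (selected σ z) →
                             All NeverExpires (selected σ y) →
                             Feasible σ (postponedSchedule σ z y)
postponedSchedule-feasible σ z y z#y z-open y-open =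
  subst (λ is → Unique (positions σ z ++ is)) (sym (ListP.concat-map-[_] (positions σ y)))
        (UniqueP.++⁺ (positions-unique σ z) (positions-unique σ y) (positions-disjoint σ z y z#y)) ,
  All-positions σ z z-open ,
  FeasibleFrom-singletons σ (positions σ y) (s≤s z≤n) (All-positions σ y y-open)

values-positions : ∀ σ b → map (λ i → value (lookupJob σ i)) (positions σ b) ≡ map value (selected σ b)
values-positions σ b = trans (ListP.map-∘ (positions σ b)) (cong (map value) (map-lookup-positions σ b))

scheduleProfit-singletons : ∀ g σ (is : List (Fin (length σ))) →
                            scheduleProfit g σ (map [_] is) ≡ soloProfit g (map (λ i → value (lookupJob σ i)) is)
scheduleProfit-singletons g σ []       = sym (soloProfit-[] g)
scheduleProfit-singletons g σ (i ∷ is) =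
  trans (cong (slotProfit g [ value (lookupJob σ i) ] +_) (scheduleProfit-singletons g σ is))
        (sym (soloProfit-∷ g (value (lookupJob σ i)) (map (λ i → value (lookupJob σ i)) is)))

postponedSchedule-profit : ∀ g σ z y → scheduleProfit g σ (postponedSchedule σ z y) ≡
                           slotProfit g (map value (selected σ z)) + soloProfit g (map value (selected σ y))
postponedSchedule-profit g σ z y =
  cong₂ _+_ (cong (slotProfit g) (values-positions σ z))
            (trans (scheduleProfit-singletons g σ (positions σ y)) (cong (soloProfit g) (values-positions σ y)))

selectedValues-selected : ∀ σ b → selectedValues σ b ≡ selected (map value σ) b
selectedValues-selected []      []          = refl
selectedValues-selected []      (_ ∷ _)     = refl
selectedValues-selected (J ∷ σ) []          = refl
selectedValues-selected (J ∷ σ) (true ∷ b)  = cong (value J ∷_) (selectedValues-selected σ b)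
selectedValues-selected (J ∷ σ) (false ∷ b) = selectedValues-selected σ b

selectedValues-positive : ∀ σ b → ValidInput σ → All (0ℚ <ℚ_) (selectedValues σ b)
selectedValues-positive σ b valid =
  subst (All (0ℚ <ℚ_)) (sym (selectedValues-selected σ b)) (All-selected b (AllP.map⁺ (All.map (proj₁ ∘ proj₂) valid)))

selectedValues-none : ∀ σ → selectedValues σ (replicate (length σ) false) ≡ []
selectedValues-none []      = refl
selectedValues-none (J ∷ σ) = selectedValues-none σ

spread-none : ∀ n bs → spread (replicate n false) bs ≡ replicate n false
spread-none zero    bs = refl
spread-none (suc n) bs = cong (false ∷_) (spread-none n bs)

orFlags-none : ∀ {n} ps → length ps ≡ n → orFlags ps (replicate n false) ≡ ps
orFlags-none []       refl = refl
orFlags-none (p ∷ ps) refl = cong₂ _∷_ (∨-identityʳ p) (orFlags-none ps refl)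

runFrom-idle : ∀ {g} A σ {ps} → g 0 ≡ 0ℚ → length ps ≡ length σ → ∀ fuel t hist →
               (∀ t′ → t ≤ t′ → availFlags σ ps t′ ≡ replicate (length σ) false) →
               runFrom g A σ fuel t ps hist ≡ 0ℚ
runFrom-idle A σ      g0 len zero       t hist idle = refl
runFrom-idle A σ {ps} g0 len (suc fuel) t hist idle
  rewrite idle t ℕP.≤-refl
        | spread-none (length σ) (A (hist ++ [ viewOf σ (replicate (length σ) false) ]))
        | selectedValues-none σ
        | orFlags-none ps len
        | g0
  = trans (QP.+-identityˡ _) (runFrom-idle A σ g0 len fuel (suc t) _ (λ t′ t<t′ → idle t′ (ℕP.<⇒≤ t<t′)))

-- The adversary

arrivalView : List ℚ → View
arrivalView = map (1 ,_)

-- The algorithm earns nothing after slot 1, while an offline schedule may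
-- postpone the jobs the algorithm processed there.
adversaryJob : Bool → ℚ → Job
adversaryJob chosen v = job 1 v (if chosen then nothing else just 1)

adversary : List ℚ → List Bool → Input
adversary []       _        = []
adversary (v ∷ vs) []       = adversaryJob false v ∷ adversary vs []
adversary (v ∷ vs) (b ∷ bs) = adversaryJob b v ∷ adversary vs bs

firstSlotFlags : List ℚ → List Bool → List Bool
firstSlotFlags ds raw = spread (replicate (length (adversary ds raw)) true) raw

adversaryJob-window₁ : ∀ b v → inWindow (adversaryJob b v) 1 ≡ true
adversaryJob-window₁ true  v = refl
adversaryJob-window₁ false v = refl

adversary-valid : ∀ {ds} raw → All (0ℚ <ℚ_) ds → ValidInput (adversary ds raw)
adversary-valid _           []           = []
adversary-valid []          (0<v ∷ 0<vs) = (s≤s z≤n , 0<v , s≤s z≤n) ∷ adversary-valid [] 0<vs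
adversary-valid (true ∷ b)  (0<v ∷ 0<vs) = (s≤s z≤n , 0<v , tt) ∷ adversary-valid b 0<vs
adversary-valid (false ∷ b) (0<v ∷ 0<vs) = (s≤s z≤n , 0<v , s≤s z≤n) ∷ adversary-valid b 0<vs

map-value-adversary : ∀ ds raw → map value (adversary ds raw) ≡ ds
map-value-adversary []       _        = refl
map-value-adversary (v ∷ vs) []       = cong (v ∷_) (map-value-adversary vs [])
map-value-adversary (v ∷ vs) (b ∷ bs) = cong (v ∷_) (map-value-adversary vs bs)

values-selected-adversary : ∀ ds raw b → map value (selected (adversary ds raw) b) ≡ selected ds b
values-selected-adversary ds raw b =
  trans (map-selected value (adversary ds raw) b) (cong (λ vs → selected vs b) (map-value-adversary ds raw))

adversary-window₁ : ∀ ds raw → All (λ J → inWindow J 1 ≡ true) (adversary ds raw)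
adversary-window₁ []       _        = []
adversary-window₁ (v ∷ vs) []       = refl ∷ adversary-window₁ vs []
adversary-window₁ (v ∷ vs) (b ∷ bs) = adversaryJob-window₁ b v ∷ adversary-window₁ vs bs

adversary-chosen-never-expire : ∀ ds raw y → Submask y raw → All NeverExpires (selected (adversary ds raw) y)
adversary-chosen-never-expire ds       raw          []          _    = []
adversary-chosen-never-expire []       raw          (_ ∷ _)     _    = []
adversary-chosen-never-expire (v ∷ vs) []           (false ∷ y) y⊆b  = adversary-chosen-never-expire vs [] y y⊆b
adversary-chosen-never-expire (v ∷ vs) []           (true ∷ y)  ()
adversary-chosen-never-expire (v ∷ vs) (b ∷ bs)     (false ∷ y) y⊆b  = adversary-chosen-never-expire vs bs y y⊆b
adversary-chosen-never-expire (v ∷ vs) (true ∷ bs)  (true ∷ y)  y⊆b  =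
  (λ { (suc t) _ → refl }) ∷ adversary-chosen-never-expire vs bs y y⊆b
adversary-chosen-never-expire (v ∷ vs) (false ∷ bs) (true ∷ y)  ()

adversary-available₁ : ∀ ds raw → availFlags (adversary ds raw) (replicate (length (adversary ds raw)) false) 1
                                  ≡ replicate (length (adversary ds raw)) true
adversary-available₁ []       _        = refl
adversary-available₁ (v ∷ vs) []       = cong (true ∷_) (adversary-available₁ vs [])
adversary-available₁ (v ∷ vs) (b ∷ bs) =
  cong₂ _∷_ (adversaryJob-window₁ b v) (adversary-available₁ vs bs)

adversary-view₁ : ∀ ds raw → viewOf (adversary ds raw) (replicate (length (adversary ds raw)) true) ≡ arrivalView ds
adversary-view₁ []       _        = refl
adversary-view₁ (v ∷ vs) []       = cong ((1 , v) ∷_) (adversary-view₁ vs [])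
adversary-view₁ (v ∷ vs) (b ∷ bs) = cong ((1 , v) ∷_) (adversary-view₁ vs bs)

selectedValues-firstSlot : ∀ ds raw → selectedValues (adversary ds raw) (firstSlotFlags ds raw) ≡ selected ds raw
selectedValues-firstSlot []       []           = refl
selectedValues-firstSlot []       (_ ∷ _)      = refl
selectedValues-firstSlot (v ∷ vs) []           = selectedValues-firstSlot vs []
selectedValues-firstSlot (v ∷ vs) (true ∷ bs)  = cong (v ∷_) (selectedValues-firstSlot vs bs)
selectedValues-firstSlot (v ∷ vs) (false ∷ bs) = selectedValues-firstSlot vs bs

orFlags-none-spread : ∀ n bs → orFlags (replicate n false) (spread (replicate n true) bs) ≡ spread (replicate n true) bs
orFlags-none-spread zero    bs       = refl
orFlags-none-spread (suc n) []       = cong (false ∷_) (orFlags-none-spread n [])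
orFlags-none-spread (suc n) (b ∷ bs) = cong (b ∷_) (orFlags-none-spread n bs)

length-spread : ∀ as bs → length (spread as bs) ≡ length as
length-spread []           bs       = refl
length-spread (false ∷ as) bs       = cong suc (length-spread as bs)
length-spread (true ∷ as)  []       = cong suc (length-spread as [])
length-spread (true ∷ as)  (b ∷ bs) = cong suc (length-spread as bs)

adversary-expired : ∀ ds raw t → availFlags (adversary ds raw) (firstSlotFlags ds raw) (suc (suc t))
                                 ≡ replicate (length (adversary ds raw)) false
adversary-expired []       _            t = refl
adversary-expired (v ∷ vs) []           t = cong (false ∷_) (adversary-expired vs [] t)
adversary-expired (v ∷ vs) (true ∷ bs)  t = cong (false ∷_) (adversary-expired vs bs t)
adversary-expired (v ∷ vs) (false ∷ bs) t = cong (false ∷_) (adversary-expired vs bs t)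

profitALG-adversary : ∀ {g} A ds → g 0 ≡ 0ℚ → ∀ T →
                      profitALG g A (adversary ds (A [ arrivalView ds ])) (suc T)
                      ≡ slotProfit g (selected ds (A [ arrivalView ds ]))
profitALG-adversary {g} A ds g0 T
  rewrite adversary-available₁ ds (A [ arrivalView ds ])
        | adversary-view₁ ds (A [ arrivalView ds ])
        | orFlags-none-spread (length (adversary ds (A [ arrivalView ds ]))) (A [ arrivalView ds ])
        | selectedValues-firstSlot ds (A [ arrivalView ds ])
  = trans (cong (slotProfit g (selected ds (A [ arrivalView ds ])) +_) idle) (QP.+-identityʳ _)
  where
  σ′ : Input
  σ′ = adversary ds (A [ arrivalView ds ])
  idle : runFrom g A σ′ T 2 (firstSlotFlags ds (A [ arrivalView ds ])) [ arrivalView ds ] ≡ 0ℚ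
  idle = runFrom-idle A σ′ g0 (trans (length-spread (replicate (length σ′) true) (A [ arrivalView ds ]))
                                      (ListP.length-replicate (length σ′))) T 2 _
           (λ { (suc (suc t)) _ → adversary-expired ds (A [ arrivalView ds ]) t ; (suc zero) (s≤s ()) })

excess : (ℕ → ℚ) → List ℚ → ℕ → ℚ
excess g ds j = nth ds j - marginal g j

greedy-≤ : ∀ {g b} → g 0 ≡ 0ℚ → ∀ xs → (∀ j → j ≤ length xs → topSum xs j - g j ≤ℚ b) → greedy g xs ≤ℚ b
greedy-≤ {g} g0 xs terms≤b =
  maxℚ-lub _ 0ℚ (AllP.map⁺ (All.map (λ j<n+1 → terms≤b _ (ℕP.≤-pred j<n+1)) (AllP.all-upTo (suc (length xs)))))
           (subst (λ x → 0ℚ - x ≤ℚ _) g0 (terms≤b 0 z≤n))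

LCR-≤ : ∀ {g r} → g 0 ≡ 0ℚ → ∀ ds i → 0ℚ <ℚ P g ds i →
        (∀ j → j ≤ length (drop i ds) → topSum (drop i ds) j - g j ≤ℚ r * P g ds i - M g ds i) →
        LCR g ds i ≤ℚ r
LCR-≤ {g} {r} g0 ds i 0<P terms≤ = /′-≤ 0<P (begin
  M g ds i + CGreedy g ds i              ≤⟨ QP.+-monoʳ-≤ (M g ds i) (greedy-≤ g0 (drop i ds) terms≤) ⟩
  M g ds i + (r * P g ds i - M g ds i)   ≡⟨ solve 2 (λ m p → m :+ (p :- m) := p) refl (M g ds i) (r * P g ds i) ⟩
  r * P g ds i                           ∎)

record LastPositive (f : ℕ → ℚ) (n m : ℕ) : Set where
  field
    m≤n         : m ≤ n
    positive    : 1 ≤ m → 0ℚ <ℚ f m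
    nonpositive : ∀ {j} → m < j → j ≤ n → ¬ (0ℚ <ℚ f j)

record LastPositiveSearch (f : ℕ → ℚ) (search : ℕ → ℕ) : Set where
  field
    search-zero : search 0 ≡ 0
    search-hit  : ∀ j → 0ℚ <ℚ f (suc j) → search (suc j) ≡ suc j
    search-miss : ∀ j → ¬ (0ℚ <ℚ f (suc j)) → search (suc j) ≡ search j

lastPositive : ∀ {f search} → LastPositiveSearch f search → ∀ n → LastPositive f n (search n)
lastPositive s zero rewrite LastPositiveSearch.search-zero s =
  record { m≤n = z≤n ; positive = λ () ; nonpositive = λ { (s≤s _) () } }
lastPositive {f} {search} s (suc n) with 0ℚ Q.<? f (suc n)
... | yes hit rewrite LastPositiveSearch.search-hit s n hit = record
  { m≤n         = ℕP.≤-refl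
  ; positive    = λ _ → hit
  ; nonpositive = λ n<j j≤n → ⊥-elim (ℕP.<⇒≱ n<j j≤n)
  }
... | no miss rewrite LastPositiveSearch.search-miss s n miss = record
  { m≤n         = ℕP.m≤n⇒m≤1+n m≤n
  ; positive    = positive
  ; nonpositive = nonpositive′
  }
  where
  open LastPositive (lastPositive s n)
  nonpositive′ : ∀ {j} → search n < j → j ≤ suc n → ¬ (0ℚ <ℚ f j)
  nonpositive′ m<j j≤1+n with ℕP.m≤n⇒m<n∨m≡n j≤1+n
  ... | inj₁ j<1+n = nonpositive m<j (ℕP.≤-pred j<1+n)
  ... | inj₂ refl  = miss

record RunningMin (f h : ℕ → ℚ) : Set where
  field
    min-one : h 1 ≡ f 1
    min-suc : ∀ k → h (suc (suc k)) ≡ h (suc k) ⊓ℚ f (suc (suc k))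

module _ {f h : ℕ → ℚ} (rm : RunningMin f h) where
  open RunningMin rm

  runningMin-≤-self : ∀ {i} → 1 ≤ i → h i ≤ℚ f i
  runningMin-≤-self {suc zero}    _ = QP.≤-reflexive min-one
  runningMin-≤-self {suc (suc i)} _ = QP.≤-trans (QP.≤-reflexive (min-suc i)) (QP.p⊓q≤q (h (suc i)) _)

  runningMin-antitone : ∀ {k} → 1 ≤ k → h (suc k) ≤ℚ h k
  runningMin-antitone {suc k} _ = QP.≤-trans (QP.≤-reflexive (min-suc k)) (QP.p⊓q≤p (h (suc k)) _)

  runningMin-≤ : ∀ {i k} → 1 ≤ i → i ℕ.≤′ k → h k ≤ℚ f i
  runningMin-≤ 1≤i ℕ.≤′-refl          = runningMin-≤-self 1≤i
  runningMin-≤ 1≤i (ℕ.≤′-step i≤′k) =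
    QP.≤-trans (runningMin-antitone (ℕP.≤-trans 1≤i (ℕP.≤′⇒≤ i≤′k))) (runningMin-≤ 1≤i i≤′k)

-- `mIndex` and `minLCR` recurse through local functions that cannot be named;
-- leaving them as metavariables lets unification recover them from `unfold`.
mIndex-lastPositive : ∀ g ds → LastPositive (excess g ds) (length ds) (mIndex g ds)
mIndex-lastPositive g ds = subst (LastPositive (excess g ds) (length ds)) (sym unfold) (lastPositive spec (length ds))
  where
  search : ℕ → ℕ
  search = _
  unfold : mIndex g ds ≡ search (length ds)
  unfold with length ds
  ... | _ = refl
  hit : ∀ j → 0ℚ <ℚ excess g ds (suc j) → search (suc j) ≡ suc j
  hit j p with 0ℚ Q.<? excess g ds (suc j)
  ... | yes _ = refl
  ... | no ¬p = ⊥-elim (¬p p)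
  miss : ∀ j → ¬ (0ℚ <ℚ excess g ds (suc j)) → search (suc j) ≡ search j
  miss j ¬p with 0ℚ Q.<? excess g ds (suc j)
  ... | yes p = ⊥-elim (¬p p)
  ... | no _  = refl
  spec : LastPositiveSearch (excess g ds) search
  spec = record { search-zero = refl ; search-hit = hit ; search-miss = miss }

minLCR-≤ : ∀ g ds {i} → 1 ≤ i → i ≤ mIndex g ds → minLCR g ds ≤ℚ LCR g ds i
minLCR-≤ g ds = bound
  where
  running : ℕ → ℚ
  running = _
  unfold : minLCR g ds ≡ running (mIndex g ds)
  unfold with mIndex g ds
  ... | _ = refl
  spec : RunningMin (LCR g ds) running
  spec = record { min-one = refl ; min-suc = λ _ → refl }
  bound : ∀ {i} → 1 ≤ i → i ≤ mIndex g ds → minLCR g ds ≤ℚ LCR g ds i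
  bound {i} 1≤i i≤m = subst (_≤ℚ LCR g ds i) (sym unfold) (runningMin-≤ spec 1≤i (ℕP.≤⇒≤′ i≤m))

-- Lower bounds on the competitive ratio

record LCRWitness (g : ℕ → ℚ) (ds : List ℚ) (m : ℕ) (r : ℚ) : Set where
  field
    index   : ℕ
    1≤index : 1 ≤ index
    index≤m : index ≤ m
    LCR≤r   : LCR g ds index ≤ℚ r

module _ {g : ℕ → ℚ} (vc : ValidCost g) (A : OnlineAlg) (r : ℚ) (comp : Competitive g A r) where
  open ValidCost vc

  adversary-bound : ∀ {ds} → All (0ℚ <ℚ_) ds → ∀ y z → Submask y (A [ arrivalView ds ]) → DisjointMasks z y →
                    slotProfit g (selected ds z) + soloProfit g (selected ds y)
                    ≤ℚ r * slotProfit g (selected ds (A [ arrivalView ds ]))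
  adversary-bound {ds} pos y z y⊆choice z#y =
    from-competitive (comp σ′ (adversary-valid choice pos) (postponedSchedule σ′ z y) feasible)
    where
    choice : List Bool
    choice = A [ arrivalView ds ]
    σ′ : Input
    σ′ = adversary ds choice
    feasible : Feasible σ′ (postponedSchedule σ′ z y)
    feasible = postponedSchedule-feasible σ′ z y z#y (All-selected z (adversary-window₁ ds choice))
                                                     (adversary-chosen-never-expire ds choice y y⊆choice)
    offline-profit : scheduleProfit g σ′ (postponedSchedule σ′ z y) ≡
                     slotProfit g (selected ds z) + soloProfit g (selected ds y)
    offline-profit = trans (postponedSchedule-profit g σ′ z y)
                           (cong₂ (λ vs ws → slotProfit g vs + soloProfit g ws)
                                  (values-selected-adversary ds choice z) (values-selected-adversary ds choice y))
    from-competitive : (∃[ T ] ∀ T′ → T ≤ T′ → scheduleProfit g σ′ (postponedSchedule σ′ z y) ≤ℚ r * profitALG g A σ′ T′) →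
                       slotProfit g (selected ds z) + soloProfit g (selected ds y) ≤ℚ r * slotProfit g (selected ds choice)
    from-competitive (T , bound) =
      subst₂ _≤ℚ_ offline-profit (cong (r *_) (profitALG-adversary A ds g-zero T)) (bound (suc T) (ℕP.n≤1+n T))

  first-job-bound : ∀ {d rest} → All (0ℚ <ℚ_) (d ∷ rest) →
                    slotProfit g [ d ] ≤ℚ r * slotProfit g (selected (d ∷ rest) (A [ arrivalView (d ∷ rest) ]))
  first-job-bound {d} {rest} pos =
    subst (_≤ℚ r * slotProfit g (selected (d ∷ rest) (A [ arrivalView (d ∷ rest) ])))
          (trans (cong (slotProfit g [ d ] +_) (soloProfit-[] g)) (QP.+-identityʳ _))
          (adversary-bound pos [] (true ∷ []) tt tt)

  competitive-ratio-≥1 : ∀ {d} → 0ℚ <ℚ d → 0ℚ <ℚ slotProfit g [ d ] → 1ℚ ≤ℚ r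
  competitive-ratio-≥1 {d} 0<d 0<p with selected-singleton d (A [ arrivalView [ d ] ])
  ... | inj₁ eq = QP.*-cancelʳ-≤-pos (slotProfit g [ d ]) {{Q.positive 0<p}} (begin
    1ℚ * slotProfit g [ d ]                                        ≡⟨ QP.*-identityˡ _ ⟩
    slotProfit g [ d ]                                             ≤⟨ first-job-bound (0<d ∷ []) ⟩
    r * slotProfit g (selected [ d ] (A [ arrivalView [ d ] ]))    ≡⟨ cong (λ vs → r * slotProfit g vs) eq ⟩
    r * slotProfit g [ d ]                                         ∎)
  ... | inj₂ eq = ⊥-elim (QP.<-irrefl refl (begin-strict
    0ℚ                                                             <⟨ 0<p ⟩
    slotProfit g [ d ]                                             ≤⟨ first-job-bound (0<d ∷ []) ⟩
    r * slotProfit g (selected [ d ] (A [ arrivalView [ d ] ]))    ≡⟨ cong (λ vs → r * slotProfit g vs) eq ⟩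
    r * slotProfit g []                                            ≡⟨ cong (r *_) (slotProfit-[] g g-zero) ⟩
    r * 0ℚ                                                         ≡⟨ QP.*-zeroʳ r ⟩
    0ℚ                                                             ∎))

  module Witness {d : ℚ} {rest : List ℚ} (desc : Descending (d ∷ rest)) (pos : All (0ℚ <ℚ_) (d ∷ rest))
                 {m : ℕ} (1≤m : 1 ≤ m) (last : LastPositive (excess g (d ∷ rest)) (length (d ∷ rest)) m) where
    open LastPositive last

    ds : List ℚ
    ds = d ∷ rest

    nonNeg : All (0ℚ ≤ℚ_) ds
    nonNeg = All.map QP.<⇒≤ pos

    choice : List Bool
    choice = A [ arrivalView ds ]

    processed : List ℚ
    processed = selected ds choice

    k : ℕ
    k = length processed

    i : ℕ
    i = k ⊓ m

    kept : List ℚ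
    kept = take i processed

    d-profitable : 0ℚ <ℚ slotProfit g [ d ]
    d-profitable = begin-strict
      0ℚ                        <⟨ positive 1≤m ⟩
      nth ds m - marginal g m   ≤⟨ QP.+-mono-≤ (nth-≤ ds (QP.≤-refl ∷ AllPairs.head desc) (QP.<⇒≤ (All.head pos)) m)
                                               (QP.neg-antimono-≤ (g₁≤marginal vc 1≤m)) ⟩
      d - g 1                   ≡⟨ cong (_- g 1) (sym (QP.+-identityʳ d)) ⟩
      slotProfit g [ d ]        ∎

    1≤r : 1ℚ ≤ℚ r
    1≤r = competitive-ratio-≥1 (All.head pos) d-profitable

    r-nonNeg : Q.NonNegative r
    r-nonNeg = Q.nonNegative (QP.≤-trans (QP.nonNegative⁻¹ 1ℚ) 1≤r)

    processed-profitable : 0ℚ <ℚ slotProfit g processed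
    processed-profitable = QP.≰⇒> λ profit≤0 → QP.<-irrefl refl (begin-strict
      0ℚ                              <⟨ d-profitable ⟩
      slotProfit g [ d ]              ≤⟨ first-job-bound pos ⟩
      r * slotProfit g processed      ≤⟨ QP.*-monoˡ-≤-nonNeg r {{r-nonNeg}} profit≤0 ⟩
      r * 0ℚ                          ≡⟨ QP.*-zeroʳ r ⟩
      0ℚ                              ∎)

    1≤i : 1 ≤ i
    1≤i = ℕP.⊓-glb (slotProfit-nonempty g g-zero processed processed-profitable) 1≤m

    i≤m : i ≤ m
    i≤m = ℕP.m⊓n≤n k m

    length-kept : length kept ≡ i
    length-kept = trans (ListP.length-take i processed) (ℕP.m≤n⇒m⊓n≡m (ℕP.m⊓n≤m k m))

    tail-below-marginals : BelowMarginals g m (drop m ds)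
    tail-below-marginals = BelowMarginals-nth m (drop m ds) below
      where
      below : ∀ j → 1 ≤ j → j ≤ length (drop m ds) → nth (drop m ds) j ≤ℚ marginal g (m ℕ.+ j)
      below (suc j) 1≤j j≤ = subst (_≤ℚ marginal g (m ℕ.+ suc j)) (sym (nth-drop m ds j))
        (p-q≤0⇒p≤q (QP.≮⇒≥ (nonpositive (ℕP.m<m+n m 1≤j) m+j≤n)))
        where
        m+j≤n : m ℕ.+ suc j ≤ length ds
        m+j≤n = subst (m ℕ.+ suc j ≤_) (ℕP.m+[n∸m]≡n m≤n)
                      (ℕP.+-monoʳ-≤ m (subst (suc j ≤_) (ListP.length-drop m ds) j≤))

    truncation-≤ : slotProfit g processed ≤ℚ slotProfit g kept
    truncation-≤ with k ℕ.≤? m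
    ... | yes k≤m = QP.≤-reflexive (cong (slotProfit g)
                      (sym (ListP.take-all i processed (ℕP.≤-reflexive (sym (ℕP.m≤n⇒m⊓n≡m k≤m))))))
    ... | no k≰m = subst (λ n → slotProfit g processed ≤ℚ slotProfit g (take n processed)) (sym i≡m) (begin
      slotProfit g processed                                    ≡⟨ cong (slotProfit g) (sym (ListP.take++drop≡id m processed)) ⟩
      slotProfit g (take m processed ++ drop m processed)       ≤⟨ slotProfit-++-≤ (take m processed) (drop m processed) drop-below ⟩
      slotProfit g (take m processed)                           ∎)
      where
      m≤k : m ≤ k
      m≤k = ℕP.<⇒≤ (ℕP.≰⇒> k≰m)
      i≡m : i ≡ m
      i≡m = ℕP.m≥n⇒m⊓n≡n m≤k
      drop-below : BelowMarginals g (length (take m processed)) (drop m processed)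
      drop-below = subst (λ n → BelowMarginals g n (drop m processed))
                         (sym (trans (ListP.length-take m processed) (ℕP.m≤n⇒m⊓n≡m m≤k)))
                         (BelowMarginals-≼ (PrefixP.drop⁺ m (selected-≼ desc choice)) tail-below-marginals)

    kept-≤-top : sumℚ kept ≤ℚ topSum ds i
    kept-≤-top = sumℚ-≼ (PrefixP.take⁺ i (selected-≼ desc choice)) (AllP.take⁺ i nonNeg)

    P-positive : 0ℚ <ℚ P g ds i
    P-positive = begin-strict
      0ℚ                        <⟨ processed-profitable ⟩
      slotProfit g processed    ≤⟨ truncation-≤ ⟩
      slotProfit g kept         ≡⟨ cong (λ n → sumℚ kept - g n) length-kept ⟩
      sumℚ kept - g i           ≤⟨ QP.+-monoˡ-≤ (- g i) kept-≤-top ⟩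
      P g ds i                  ∎

    keptMask : List Bool
    keptMask = firstTrues i choice

    rejected : List ℚ
    rejected = unselected ds keptMask

    selected-keptMask : selected ds keptMask ≡ kept
    selected-keptMask = selected-firstTrues ds i choice

    drop-≼-rejected : drop i ds ≼ rejected
    drop-≼-rejected = subst (λ n → drop n ds ≼ rejected) (trans (cong length selected-keptMask) length-kept)
                            (drop-selected-≼-unselected desc keptMask)

    greedy-term-≤ : ∀ j → j ≤ length (drop i ds) → topSum (drop i ds) j - g j ≤ℚ r * P g ds i - M g ds i
    greedy-term-≤ j j≤ = ratio-bound-mono 1≤r kept-≤-top (begin
      (topSum (drop i ds) j - g j) + (sumℚ kept - ℕtoℚ i * g 1)
        ≤⟨ QP.+-monoˡ-≤ _ (QP.+-monoˡ-≤ (- g j) top-≤-fresh) ⟩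
      (sumℚ fresh - g j) + (sumℚ kept - ℕtoℚ i * g 1)
        ≡⟨ cong₂ (λ a b → (sumℚ fresh - g a) + (sumℚ kept - ℕtoℚ b * g 1)) (sym length-fresh) (sym length-kept) ⟩
      slotProfit g fresh + soloProfit g kept
        ≡⟨ cong₂ (λ a b → slotProfit g a + soloProfit g b) (sym selected-fresh) (sym selected-keptMask) ⟩
      slotProfit g (selected ds (firstFalses j keptMask)) + soloProfit g (selected ds keptMask)
        ≤⟨ adversary-bound pos keptMask (firstFalses j keptMask) (firstTrues-submask i choice) (firstFalses-disjoint j keptMask) ⟩
      r * slotProfit g processed
        ≤⟨ QP.*-monoˡ-≤-nonNeg r {{r-nonNeg}} truncation-≤ ⟩
      r * slotProfit g kept
        ≡⟨ cong (λ n → r * (sumℚ kept - g n)) length-kept ⟩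
      r * (sumℚ kept - g i)
        ∎)
      where
      fresh : List ℚ
      fresh = take j rejected
      selected-fresh : selected ds (firstFalses j keptMask) ≡ fresh
      selected-fresh = selected-firstFalses ds j keptMask
      length-fresh : length fresh ≡ j
      length-fresh = trans (ListP.length-take j rejected)
                           (ℕP.m≤n⇒m⊓n≡m (ℕP.≤-trans j≤ (PrefixP.length-mono drop-≼-rejected)))
      top-≤-fresh : topSum (drop i ds) j ≤ℚ sumℚ fresh
      top-≤-fresh = sumℚ-≼ (PrefixP.take⁺ j drop-≼-rejected) (AllP.take⁺ j (All-unselected keptMask nonNeg))

    LCRᵢ≤r : LCR g ds i ≤ℚ r
    LCRᵢ≤r = LCR-≤ g-zero ds i P-positive greedy-term-≤

  lcrWitness : ∀ {ds} → Descending ds → All (0ℚ <ℚ_) ds →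
               ∀ {m} → 1 ≤ m → LastPositive (excess g ds) (length ds) m → LCRWitness g ds m r
  lcrWitness {[]} _ _ 1≤m last with ℕP.≤-trans 1≤m (LastPositive.m≤n last)
  ... | ()
  lcrWitness {d ∷ rest} desc pos 1≤m last = record { index = i ; 1≤index = 1≤i ; index≤m = i≤m ; LCR≤r = LCRᵢ≤r }
    where open Witness desc pos 1≤m last

lemma3p5 : (g : ℕ → ℚ) → ValidCost g →
           (σ : Input) → ValidInput σ →
           (S : ℕ → List Bool) → MinLCRRun g σ S →
           (A : OnlineAlg) → (r : ℚ) → Competitive g A r →
           ∀ τ → 1 ≤ τ → 1 ≤ mIndex g (Evalues σ S τ) →
           LCR g (Evalues σ S τ) (countTrue (S τ)) Q.≤ r
lemma3p5 g vc σ vσ S run A r comp τ 1≤τ 1≤m = begin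
  LCR g ds (countTrue (S τ))  ≡⟨ MinLCRRun.argmin run τ 1≤τ 1≤m ⟩
  minLCR g ds                 ≤⟨ minLCR-≤ g ds 1≤index index≤m ⟩
  LCR g ds index              ≤⟨ LCR≤r ⟩
  r                           ∎
  where
  values : List ℚ
  values = selectedValues σ (Eflags σ S τ)
  ds : List ℚ
  ds = sortDesc values
  open LCRWitness (lcrWitness vc A r comp (sortDesc-descending values) (sortDesc-All (selectedValues-positive σ (Eflags σ S τ) vσ))
                              1≤m (mIndex-lastPositive g ds))
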